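{- Let $G$ be a finite connected graph and let $J$ be a finite disconnected graph with $n \geq 2$ components. Then $c_H(G \vee J) \leq c_H(G) + 2$.
   Context: The join $G \vee J$ has vertex set $V(G) \cup V(J)$ (disjoint union) and edge set $E(G) \cup E(J) \cup \{uv : u \in V(G), v \in V(J)\}$. Hyperopic Cops and Robber on a graph $H$ (each vertex considered to carry a loop, so a player may stay put): the cops first occupy a multiset of vertices, then the robber chooses a vertex. In each round, each cop moves to an adjacent vertex or stays, then the robber moves to an adjacent vertex or stays. The robber always sees all cops. The cops see the robber's position except when the robber's vertex is adjacent to every vertex occupied by a cop, in which case the robber is invisible. The robber is captured when a cop occupies the robber's vertex. $c_H(H)$ is the minimum number of cops that can guarantee capture in finitely many moves. -}

module Defs where

open import Data.Nat using (ℕ; zero; suc; _+_; _<_)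
open import Data.Fin using (Fin; splitAt)
open import Data.Bool using (Bool; true; false; if_then_else_; _∧_)
open import Data.Maybe using (Maybe; just; nothing)
open import Data.List using (List; []; _∷_)
open import Data.Sum using (_⊎_; inj₁; inj₂)
open import Data.Product using (Σ; _×_; ∃; ∃-syntax; _,_)
open import Relation.Nullary using (¬_)
open import Relation.Binary.PropositionalEquality using (_≡_; refl)

record Graph : Set where
  field
    n          : ℕ
    adj        : Fin n → Fin n → Bool
    adj-sym    : ∀ u v → adj u v ≡ adj v u
    adj-irrefl : ∀ v → adj v v ≡ false

open Graph public

V : Graph → Set
V G = Fin (n G)

Adj : (G : Graph) → V G → V G → Set
Adj G u v = adj G u v ≡ true

data Reach (G : Graph) : V G → V G → Set where
  here : ∀ {u} → Reach G u u
  step : ∀ {u v w} → Adj G u v → Reach G v w → Reach G u w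

Connected : Graph → Set
Connected G = (0 < n G) × (∀ u v → Reach G u v)

Disconnected : Graph → Set
Disconnected G = ∃[ u ] ∃[ v ] ¬ Reach G u v

private
  adjSum : (G J : Graph) → V G ⊎ V J → V G ⊎ V J → Bool
  adjSum G J (inj₁ a) (inj₁ b) = adj G a b
  adjSum G J (inj₂ a) (inj₂ b) = adj J a b
  adjSum G J (inj₁ a) (inj₂ b) = true
  adjSum G J (inj₂ a) (inj₁ b) = true

  adjSum-sym : ∀ G J x y → adjSum G J x y ≡ adjSum G J y x
  adjSum-sym G J (inj₁ a) (inj₁ b) = adj-sym G a b
  adjSum-sym G J (inj₂ a) (inj₂ b) = adj-sym J a b
  adjSum-sym G J (inj₁ a) (inj₂ b) = refl
  adjSum-sym G J (inj₂ a) (inj₁ b) = refl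

  adjSum-irr : ∀ G J x → adjSum G J x x ≡ false
  adjSum-irr G J (inj₁ a) = adj-irrefl G a
  adjSum-irr G J (inj₂ a) = adj-irrefl J a

infixr 5 _∨ᴳ_
_∨ᴳ_ : Graph → Graph → Graph
G ∨ᴳ J = record
  { n = n G + n J
  ; adj = λ u v → adjSum G J (splitAt (n G) u) (splitAt (n G) v)
  ; adj-sym = λ u v → adjSum-sym G J (splitAt (n G) u) (splitAt (n G) v)
  ; adj-irrefl = λ v → adjSum-irr G J (splitAt (n G) v)
  }

Step : (G : Graph) → V G → V G → Set
Step G u v = (u ≡ v) ⊎ Adj G u v

Config : Graph → ℕ → Set
Config G k = Fin k → V G

allB : (k : ℕ) → (Fin k → Bool) → Bool
allB zero    f = true
allB (suc k) f = f Fin.zero ∧ allB k (λ i → f (Fin.suc i))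

observe : (G : Graph) (k : ℕ) → Config G k → V G → Maybe (V G)
observe G k c r = if allB k (λ i → adj G r (c i)) then nothing else just r

-- a (deterministic) cop strategy: from the list of observations so far
-- (newest first) to the next configuration; on [] it gives the initial placement
CopStrategy : Graph → ℕ → Set
CopStrategy G k = List (Maybe (V G)) → Config G k

-- a robber play: r 0 is the initial vertex, r (t+1) the vertex after round t+1
RobberPlay : Graph → Set
RobberPlay G = ℕ → V G

LegalRobber : (G : Graph) → RobberPlay G → Set
LegalRobber G r = ∀ t → Step G (r t) (r (suc t))

module Play (G : Graph) (k : ℕ) (σ : CopStrategy G k) (r : RobberPlay G) where
  hist : ℕ → List (Maybe (V G))
  hist zero    = []
  hist (suc t) = observe G k (σ (hist t)) (r t) ∷ hist t

  cops : ℕ → Config G k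
  cops t = σ (hist t)

  CopsLegal : Set
  CopsLegal = ∀ t i → Step G (cops t i) (cops (suc t) i)

  -- some cop is on the robber's vertex, either after the robber's
  -- placement/move at time t, or after the cops' move in round t+1
  Captured : Set
  Captured = ∃[ t ] ∃[ i ] ((cops t i ≡ r t) ⊎ (cops (suc t) i ≡ r t))

CopsWin : Graph → ℕ → Set
CopsWin G k =
  Σ (CopStrategy G k) λ σ →
    ∀ (r : RobberPlay G) → LegalRobber G r →
      Play.CopsLegal G k σ r × Play.Captured G k σ r

-- The k chasers play a winning strategy for G against the robber's shadow in G, while two
-- guards sit in different components of J. A robber in G is adjacent to both guards, so the
-- cops see exactly what the simulated game shows; a robber in J is adjacent to at most one
-- guard, so he is seen as soon as he enters J, and since all of G is adjacent to all of J
-- every chaser then lands on the vertex where he was seen. If he never leaves G before the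
-- simulated capture, that capture is a real one.
module Submission where

open import Defs
open import Data.Bool using (Bool; true; false; if_then_else_; _∧_)
open import Data.Bool.Properties using (∧-assoc; ∧-identityʳ; ∧-conicalˡ; ∧-conicalʳ)
open import Data.Empty using (⊥)
open import Data.Fin using (Fin; zero; suc; splitAt; _↑ˡ_; _↑ʳ_; fromℕ<)
open import Data.Fin.Properties using (splitAt-↑ˡ; splitAt-↑ʳ; splitAt⁻¹-↑ˡ; splitAt⁻¹-↑ʳ; ↑ˡ-injective)
open import Data.List using (List; []; _∷_; map)
open import Data.Maybe using (Maybe; just; nothing; maybe′; _>>=_; _<∣>_)
import Data.Maybe as Maybe
open import Data.Nat using (ℕ; zero; suc; _+_)
open import Data.Product using (∃-syntax; _×_; _,_; proj₁; proj₂)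
open import Data.Sum using (inj₁; inj₂; [_,_]′; fromInj₁)
import Data.Sum as Sum
open import Data.Vec.Functional using (Vector; _++_)
open import Data.Vec.Functional.Properties using (lookup-++ˡ; lookup-++ʳ; ++-cong)
open import Function using (_∘_; const)
open import Relation.Nullary using (¬_)
open import Relation.Binary.PropositionalEquality

allB-sound : ∀ {m} {f : Fin m → Bool} → allB m f ≡ true → ∀ i → f i ≡ true
allB-sound {suc m} {f} all zero    = ∧-conicalˡ (f zero) _ all
allB-sound {suc m} {f} all (suc i) = allB-sound (∧-conicalʳ (f zero) _ all) i

allB-cong : ∀ {m} {f g : Fin m → Bool} → f ≗ g → allB m f ≡ allB m g
allB-cong {zero}  f≗g = refl
allB-cong {suc m} f≗g = cong₂ _∧_ (f≗g zero) (allB-cong (f≗g ∘ suc))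

allB-const : ∀ m → allB m (const true) ≡ true
allB-const zero    = refl
allB-const (suc m) = allB-const m

allB-++ : ∀ {A : Set} {k m} (f : A → Bool) (c : Vector A k) (d : Vector A m) →
  allB (k + m) (f ∘ (c ++ d)) ≡ allB k (f ∘ c) ∧ allB m (f ∘ d)
allB-++ {k = zero}      f c d = refl
allB-++ {k = suc k} {m} f c d = begin
  f (c zero) ∧ allB (k + m) (f ∘ (c ++ d) ∘ suc)
    ≡⟨ cong (f (c zero) ∧_) (allB-cong (cong f ∘ ++-suc)) ⟩
  f (c zero) ∧ allB (k + m) (f ∘ (c ∘ suc ++ d))
    ≡⟨ cong (f (c zero) ∧_) (allB-++ f (c ∘ suc) d) ⟩
  f (c zero) ∧ (allB k (f ∘ c ∘ suc) ∧ allB m (f ∘ d))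
    ≡⟨ ∧-assoc (f (c zero)) _ _ ⟨
  (f (c zero) ∧ allB k (f ∘ c ∘ suc)) ∧ allB m (f ∘ d) ∎
  where
  open ≡-Reasoning
  ++-suc : (c ++ d) ∘ suc ≗ c ∘ suc ++ d
  ++-suc i with splitAt k i
  ... | inj₁ _ = refl
  ... | inj₂ _ = refl

<∣>-nothing : ∀ {A : Set} (x : Maybe A) {y} → x <∣> y ≡ nothing → x ≡ nothing × y ≡ nothing
<∣>-nothing nothing  x<∣>y≡nothing = refl , x<∣>y≡nothing
<∣>-nothing (just _) ()

observe-cong : ∀ {H k} {c c′ : Config H k} x → c ≗ c′ → observe H k c x ≡ observe H k c′ x
observe-cong {H} x c≗c′ =
  cong (λ b → if b then nothing else just x) (allB-cong (cong (adj H x) ∘ c≗c′))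

observe-visible : ∀ {H k} (c : Config H k) {x} i → adj H x (c i) ≡ false → observe H k c x ≡ just x
observe-visible {H} {k} c {x} i x≁ci with allB k (adj H x ∘ c) in all
... | false = refl
... | true with () ← trans (sym x≁ci) (allB-sound all i)

Step-++ : ∀ {H k m} {c c′ : Config H k} {d d′ : Config H m} →
  (∀ i → Step H (c i) (c′ i)) → (∀ j → Step H (d j) (d′ j)) →
  ∀ i → Step H ((c ++ d) i) ((c′ ++ d′) i)
Step-++ {k = k} c→c′ d→d′ i with splitAt k i
... | inj₁ i′ = c→c′ i′
... | inj₂ j  = d→d′ j

separated⇒no-common-neighbour : ∀ {J a b v} → ¬ Reach J a b → Adj J v a → Adj J v b → ⊥
separated⇒no-common-neighbour {J} a↛b v~a v~b = a↛b (step (trans (adj-sym J _ _) v~a) (step v~b here))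

module Join (G J : Graph) where

  embG : V G → V (G ∨ᴳ J)
  embG g = g ↑ˡ n J

  embJ : V J → V (G ∨ᴳ J)
  embJ v = n G ↑ʳ v

  inG : V (G ∨ᴳ J) → Bool
  inG x = [ const true , const false ]′ (splitAt (n G) x)

  inG-true : ∀ {x} g → inG x ≡ true → x ≡ embG (fromInj₁ (const g) (splitAt (n G) x))
  inG-true {x} g x∈G with splitAt (n G) x in eq
  ... | inj₁ _ = sym (splitAt⁻¹-↑ˡ eq)

  inG-false : ∀ {x} → inG x ≡ false → ∃[ v ] x ≡ embJ v
  inG-false {x} x∉G with splitAt (n G) x in eq
  ... | inj₂ v = v , sym (splitAt⁻¹-↑ʳ eq)

  adj-embG-embG : ∀ g g′ → adj (G ∨ᴳ J) (embG g) (embG g′) ≡ adj G g g′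
  adj-embG-embG g g′ rewrite splitAt-↑ˡ (n G) g (n J) | splitAt-↑ˡ (n G) g′ (n J) = refl

  adj-embJ-embJ : ∀ v v′ → adj (G ∨ᴳ J) (embJ v) (embJ v′) ≡ adj J v v′
  adj-embJ-embJ v v′ rewrite splitAt-↑ʳ (n G) (n J) v | splitAt-↑ʳ (n G) (n J) v′ = refl

  adj-embG-embJ : ∀ g v → adj (G ∨ᴳ J) (embG g) (embJ v) ≡ true
  adj-embG-embJ g v rewrite splitAt-↑ˡ (n G) g (n J) | splitAt-↑ʳ (n G) (n J) v = refl

  embG-step : ∀ {g g′} → Step G g g′ → Step (G ∨ᴳ J) (embG g) (embG g′)
  embG-step (inj₁ g≡g′) = inj₁ (cong embG g≡g′)
  embG-step (inj₂ g~g′) = inj₂ (trans (adj-embG-embG _ _) g~g′)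

  embG-step⁻¹ : ∀ {g g′} → Step (G ∨ᴳ J) (embG g) (embG g′) → Step G g g′
  embG-step⁻¹ (inj₁ eq) = inj₁ (↑ˡ-injective (n J) _ _ eq)
  embG-step⁻¹ (inj₂ g~g′) = inj₂ (trans (sym (adj-embG-embG _ _)) g~g′)

  observe-embG : ∀ {k m} (c : Config G k) (d : Config J m) g →
    observe (G ∨ᴳ J) (k + m) (embG ∘ c ++ embJ ∘ d) (embG g) ≡ Maybe.map embG (observe G k c g)
  observe-embG {k} {m} c d g =
    trans (cong (λ b → if b then nothing else just (embG g)) cops-adjacent) (if-map (allB k (adj G g ∘ c)))
    where
    open ≡-Reasoning
    cops-adjacent : allB (k + m) (adj (G ∨ᴳ J) (embG g) ∘ (embG ∘ c ++ embJ ∘ d)) ≡ allB k (adj G g ∘ c)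
    cops-adjacent = begin
      allB (k + m) (adj (G ∨ᴳ J) (embG g) ∘ (embG ∘ c ++ embJ ∘ d))
        ≡⟨ allB-++ (adj (G ∨ᴳ J) (embG g)) (embG ∘ c) (embJ ∘ d) ⟩
      allB k (adj (G ∨ᴳ J) (embG g) ∘ embG ∘ c) ∧ allB m (adj (G ∨ᴳ J) (embG g) ∘ embJ ∘ d)
        ≡⟨ cong₂ _∧_ (allB-cong (adj-embG-embG g ∘ c)) (allB-cong (adj-embG-embJ g ∘ d)) ⟩
      allB k (adj G g ∘ c) ∧ allB m (const true)
        ≡⟨ cong (allB k (adj G g ∘ c) ∧_) (allB-const m) ⟩
      allB k (adj G g ∘ c) ∧ true
        ≡⟨ ∧-identityʳ _ ⟩
      allB k (adj G g ∘ c) ∎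
    if-map : ∀ b → (if b then nothing else just (embG g)) ≡ Maybe.map embG (if b then nothing else just g)
    if-map true  = refl
    if-map false = refl

  adj-embJ-++ : ∀ {k m} (c : Config (G ∨ᴳ J) k) (d : Config J m) v i →
    adj (G ∨ᴳ J) (embJ v) ((c ++ embJ ∘ d) (k ↑ʳ i)) ≡ adj J v (d i)
  adj-embJ-++ c d v i = trans (cong (adj (G ∨ᴳ J) (embJ v)) (lookup-++ʳ c (embJ ∘ d) i)) (adj-embJ-embJ v (d i))

  -- Guards in different components of J have no common neighbour in J.
  observe-embJ : ∀ {k m} (c : Config (G ∨ᴳ J) k) (d : Config J m) i j → ¬ Reach J (d i) (d j) →
    ∀ v → observe (G ∨ᴳ J) (k + m) (c ++ embJ ∘ d) (embJ v) ≡ just (embJ v)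
  observe-embJ {k} c d i j di↛dj v with adj J v (d i) in v~di | adj J v (d j) in v~dj
  ... | false | _     = observe-visible {G ∨ᴳ J} (c ++ embJ ∘ d) (k ↑ʳ i) (trans (adj-embJ-++ c d v i) v~di)
  ... | true  | false = observe-visible {G ∨ᴳ J} (c ++ embJ ∘ d) (k ↑ʳ j) (trans (adj-embJ-++ c d v j) v~dj)
  ... | true  | true with () ← separated⇒no-common-neighbour di↛dj v~di v~dj

module JoinStrategy {G J : Graph} {k} (σ : CopStrategy G k) (a b : V J) where
  open Join G J

  restrict : Maybe (V (G ∨ᴳ J)) → Maybe (V G)
  restrict o = o >>= [ just , const nothing ]′ ∘ splitAt (n G)

  sighting : Maybe (V (G ∨ᴳ J)) → Maybe (V J)
  sighting o = o >>= [ const nothing , just ]′ ∘ splitAt (n G)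

  -- histories are newest first, so the earliest sighting lies in the tail
  firstSighting : List (Maybe (V (G ∨ᴳ J))) → Maybe (V J)
  firstSighting []      = nothing
  firstSighting (o ∷ h) = firstSighting h <∣> sighting o

  chasers : List (Maybe (V (G ∨ᴳ J))) → Config (G ∨ᴳ J) k
  chasers h i = maybe′ embJ (embG (σ (map restrict h) i)) (firstSighting h)

  guards : Config J 2
  guards zero    = a
  guards (suc _) = b

  σ∨ : CopStrategy (G ∨ᴳ J) (k + 2)
  σ∨ h = chasers h ++ embJ ∘ guards

  restrict-embG : ∀ o → restrict (Maybe.map embG o) ≡ o
  restrict-embG nothing  = refl
  restrict-embG (just g) rewrite splitAt-↑ˡ (n G) g (n J) = refl

  sighting-embG : ∀ o → sighting (Maybe.map embG o) ≡ nothing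
  sighting-embG nothing  = refl
  sighting-embG (just g) rewrite splitAt-↑ˡ (n G) g (n J) = refl

  sighting-embJ : ∀ v → sighting (just (embJ v)) ≡ just v
  sighting-embJ v rewrite splitAt-↑ʳ (n G) (n J) v = refl

  chasers-unseen : ∀ h → firstSighting h ≡ nothing → ∀ i → chasers h i ≡ embG (σ (map restrict h) i)
  chasers-unseen _ unseen i = cong (maybe′ embJ _) unseen

  chasers-seen : ∀ h {v} → firstSighting h ≡ just v → ∀ i → chasers h i ≡ embJ v
  chasers-seen _ seen i = cong (maybe′ embJ _) seen

  module Against (g₀ : V G) (a↛b : ¬ Reach J a b)
                 (σ-wins : ∀ r → LegalRobber G r → Play.CopsLegal G k σ r × Play.Captured G k σ r)
                 (r : RobberPlay (G ∨ᴳ J)) (r-legal : LegalRobber (G ∨ᴳ J) r) where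

    stillInG : ℕ → Bool
    stillInG zero    = inG (r zero)
    stillInG (suc t) = stillInG t ∧ inG (r (suc t))

    -- the robber's moves projected to G, frozen once he has entered J
    shadow : RobberPlay G
    shadow zero    = fromInj₁ (const g₀) (splitAt (n G) (r zero))
    shadow (suc t) = if stillInG (suc t) then fromInj₁ (const g₀) (splitAt (n G) (r (suc t))) else shadow t

    stillInG-prev : ∀ {t} → stillInG (suc t) ≡ true → stillInG t ≡ true
    stillInG-prev {t} = ∧-conicalˡ (stillInG t) _

    stillInG-at : ∀ t → stillInG t ≡ true → r t ≡ embG (shadow t)
    stillInG-at zero    inside = inG-true g₀ inside
    stillInG-at (suc t) inside rewrite inside = inG-true g₀ (∧-conicalʳ (stillInG t) _ inside)

    shadow-legal : LegalRobber G shadow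
    shadow-legal t with stillInG (suc t) in inside
    ... | false = inj₁ refl
    ... | true  = embG-step⁻¹ (subst₂ (Step (G ∨ᴳ J))
                    (stillInG-at t (stillInG-prev inside))
                    (inG-true g₀ (∧-conicalʳ (stillInG t) _ inside))
                    (r-legal t))

    open Play (G ∨ᴳ J) (k + 2) σ∨ r
    module Sim = Play G k σ shadow

    observation : ℕ → Maybe (V (G ∨ᴳ J))
    observation t = observe (G ∨ᴳ J) (k + 2) (cops t) (r t)

    Undetected : ℕ → Set
    Undetected t = map restrict (hist t) ≡ Sim.hist t × firstSighting (hist t) ≡ nothing

    chasers-undetected : ∀ {t} → Undetected t → chasers (hist t) ≗ embG ∘ Sim.cops t
    chasers-undetected (restricted , unseen) i =
      trans (chasers-unseen (hist _) unseen i) (cong (λ h → embG (σ h i)) restricted)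

    chaser-position : ∀ {t} → Undetected t → ∀ i → cops t (i ↑ˡ 2) ≡ embG (Sim.cops t i)
    chaser-position {t} u i = trans (lookup-++ˡ (chasers (hist t)) _ i) (chasers-undetected u i)

    observation-in-G : ∀ {t} → Undetected t → r t ≡ embG (shadow t) →
      observation t ≡ Maybe.map embG (observe G k (Sim.cops t) (shadow t))
    observation-in-G {t} u rt≡ = begin
      observe (G ∨ᴳ J) (k + 2) (cops t) (r t)
        ≡⟨ cong (observe (G ∨ᴳ J) (k + 2) (cops t)) rt≡ ⟩
      observe (G ∨ᴳ J) (k + 2) (cops t) (embG (shadow t))
        ≡⟨ observe-cong {G ∨ᴳ J} (embG (shadow t)) (++-cong _ _ (chasers-undetected u) (λ _ → refl)) ⟩
      observe (G ∨ᴳ J) (k + 2) (embG ∘ Sim.cops t ++ embJ ∘ guards) (embG (shadow t))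
        ≡⟨ observe-embG (Sim.cops t) guards (shadow t) ⟩
      Maybe.map embG (observe G k (Sim.cops t) (shadow t)) ∎
      where open ≡-Reasoning

    observation-in-J : ∀ {t v} → r t ≡ embJ v → sighting (observation t) ≡ just v
    observation-in-J {t} {v} rt≡ = trans
      (cong sighting (trans (cong (observe (G ∨ᴳ J) (k + 2) (cops t)) rt≡)
                            (observe-embJ (chasers (hist t)) guards zero (suc zero) a↛b v)))
      (sighting-embJ v)

    undetected-step : ∀ {t} → Undetected t → r t ≡ embG (shadow t) → Undetected (suc t)
    undetected-step {t} u@(restricted , unseen) rt≡ =
      cong₂ _∷_ (trans (cong restrict obs) (restrict-embG simulated)) restricted ,
      cong₂ _<∣>_ unseen (trans (cong sighting obs) (sighting-embG simulated))
      where
      simulated = observe G k (Sim.cops t) (shadow t)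
      obs = observation-in-G u rt≡

    undetected : ∀ t → stillInG t ≡ true → Undetected (suc t)
    undetected zero    inside = undetected-step (refl , refl) (stillInG-at zero inside)
    undetected (suc t) inside =
      undetected-step (undetected t (stillInG-prev inside)) (stillInG-at (suc t) inside)

    undetected-now : ∀ t → stillInG t ≡ true → Undetected t
    undetected-now zero    _      = refl , refl
    undetected-now (suc t) inside = undetected t (stillInG-prev inside)

    inG-unless-sighted : ∀ t → sighting (observation t) ≡ nothing → inG (r t) ≡ true
    inG-unless-sighted t unsighted with inG (r t) in rt∈G
    ... | true  = refl
    ... | false with v , rt≡ ← inG-false rt∈G
                with () ← trans (sym (observation-in-J rt≡)) unsighted

    unseen⇒stillInG : ∀ t → firstSighting (hist (suc t)) ≡ nothing → stillInG t ≡ true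
    unseen⇒stillInG zero    unseen = inG-unless-sighted zero unseen
    unseen⇒stillInG (suc t) unseen with <∣>-nothing (firstSighting (hist (suc t))) unseen
    ... | unseen-before , unsighted =
      cong₂ _∧_ (unseen⇒stillInG t unseen-before) (inG-unless-sighted (suc t) unsighted)

    chasers-step : ∀ t i → Step (G ∨ᴳ J) (chasers (hist t) i) (chasers (hist (suc t)) i)
    chasers-step t i = by-sightings (firstSighting (hist t)) refl (sighting (observation t)) refl
      where
      by-sightings : ∀ s₀ → firstSighting (hist t) ≡ s₀ → ∀ s₁ → sighting (observation t) ≡ s₁ →
        Step (G ∨ᴳ J) (chasers (hist t) i) (chasers (hist (suc t)) i)
      by-sightings (just v) seen₀ _ _ =
        inj₁ (trans (chasers-seen (hist t) seen₀ i) (sym (chasers-seen (hist (suc t)) (cong (_<∣> sighting (observation t)) seen₀) i)))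
      by-sightings nothing seen₀ (just w) seen₁ =
        subst₂ (Step (G ∨ᴳ J)) (sym (chasers-unseen (hist t) seen₀ i)) (sym (chasers-seen (hist (suc t)) (cong₂ _<∣>_ seen₀ seen₁) i))
          (inj₂ (adj-embG-embJ _ w))
      by-sightings nothing seen₀ nothing seen₁ =
        subst₂ (Step (G ∨ᴳ J))
          (sym (chasers-undetected (undetected-now t inside) i)) (sym (chasers-undetected (undetected t inside) i))
          (embG-step (proj₁ (σ-wins shadow shadow-legal) t i))
        where inside = unseen⇒stillInG t (cong₂ _<∣>_ seen₀ seen₁)

    cops-legal : CopsLegal
    cops-legal t = Step-++ {G ∨ᴳ J} (chasers-step t) (λ _ → inj₁ refl)

    first-escape : ∀ t → stillInG t ≡ false → ∃[ s ] ∃[ v ] r s ≡ embJ v × Undetected s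
    first-escape zero outside = zero , proj₁ (inG-false outside) , proj₂ (inG-false outside) , refl , refl
    first-escape (suc t) outside with stillInG t in inside
    ... | false = first-escape t inside
    ... | true  = suc t , proj₁ (inG-false outside) , proj₂ (inG-false outside) , undetected t inside

    captured-after-escape : ∀ {s v} → r s ≡ embJ v → Undetected s → Fin k → Captured
    captured-after-escape {s} {v} rs≡ (_ , unseen) i = s , i ↑ˡ 2 , inj₂ (begin
      cops (suc s) (i ↑ˡ 2)        ≡⟨ lookup-++ˡ (chasers (hist (suc s))) _ i ⟩
      chasers (hist (suc s)) i     ≡⟨ chasers-seen (hist (suc s)) (cong₂ _<∣>_ unseen (observation-in-J rs≡)) i ⟩
      embJ v                       ≡⟨ rs≡ ⟨
      r s                          ∎)
      where open ≡-Reasoning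

    captured : Captured
    captured with proj₂ (σ-wins shadow shadow-legal)
    ... | t , i , caught with stillInG t in inside
    ...   | false with s , v , rs≡ , u ← first-escape t inside = captured-after-escape rs≡ u i
    ...   | true  = t , i ↑ˡ 2 , Sum.map (catch (undetected-now t inside)) (catch (undetected t inside)) caught
      where
      catch : ∀ {t′} → Undetected t′ → Sim.cops t′ i ≡ shadow t → cops t′ (i ↑ˡ 2) ≡ r t
      catch u caught = trans (chaser-position u i) (trans (cong embG caught) (sym (stillInG-at t inside)))

theorem4p6 : (G J : Graph) → Connected G → Disconnected J →
    (k : ℕ) → CopsWin G k → CopsWin (G ∨ᴳ J) (k + 2)
theorem4p6 G J (0<n , _) (a , b , a↛b) k (σ , σ-wins) =
  σ∨ , λ r r-legal → let open Against (fromℕ< 0<n) a↛b σ-wins r r-legal in cops-legal , captured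
  where open JoinStrategy σ a b
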